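{- Let $p=2$. For a square-free integer $\ell>0$ with $\ell\equiv 7 \pmod 8$, let $K=\mathbb{Q}(\sqrt{ -\ell})$, $\omega_\ell=\frac{ -1+\sqrt{ -\ell}}{2}$, $\mathcal{O}_K=\mathbb{Z}[\omega_\ell]$, and $\mathcal{R}=\mathcal{O}_K/2\mathcal{O}_K=\{0,1,\omega,\omega+1\}\cong\mathbb{F}_2\times\mathbb{F}_2$, where $\omega$ is the image of $\omega_\ell$ (so $\omega^2+\omega=0$ in $\mathcal{R}$). For any integer $n\geq 2$, consider the length-$n$ codes $$C_{n,1}=\omega\langle(0,\dots,0,1,1)\rangle+(\omega+1)\langle(0,\dots,0,1,1)\rangle^\perp,\qquad C_{n,2}=\omega\langle(0,\dots,0,0,1)\rangle+(\omega+1)\langle(0,\dots,0,0,1)\rangle^\perp$$ in $\mathcal{R}^n$. Then $swe_{C_{n,1}}\neq swe_{C_{n,2}}$, the level-$7$ theta series coincide, $\theta_{\Lambda_7(C_{n,1})}(q)=\theta_{\Lambda_7(C_{n,2})}(q)$, and for every square-free $\ell>7$ with $\ell\equiv 7\pmod 8$ the level-$\ell$ theta series differ, $\theta_{\Lambda_\ell(C_{n,1})}(q)\neq\theta_{\Lambda_\ell(C_{n,2})}(q)$.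
   Context: Conventions. For $\mathbf{v}\in\mathcal{R}^n$, $\langle\mathbf{v}\rangle=\{c\mathbf{v}: c\in\mathcal{R}\}$ is the $\mathcal{R}$-submodule generated by $\mathbf{v}$, and for a submodule $C\subseteq\mathcal{R}^n$, $C^\perp=\{u\in\mathcal{R}^n: \sum_i u_i\overline{v_i}=0 \text{ for all } v\in C\}$, where conjugation on $\mathcal{R}$ is induced by complex conjugation on $\mathcal{O}_K$, i.e. $\overline{a+b\omega}=(a-b)-b\omega$. For $a_1,a_2\in\mathcal{R}$, $a_1\langle\mathbf{v}\rangle+a_2\langle\mathbf{v}\rangle^\perp=\{a_1x+a_2y : x\in\langle\mathbf{v}\rangle, y\in\langle\mathbf{v}\rangle^\perp\}$. Symmetric weight enumerator: for a code $C\subseteq\mathcal{R}^n$, $swe_C(X,Y,Z)=\sum_{u\in C}X^{n_0(u)}Y^{n_1(u)}Z^{n_\omega(u)+n_{\omega+1}(u)}$, where $n_r(u)$ is the number of coordinates of $u$ equal to $r\in\mathcal{R}$. Construction A and theta series: with $\rho_\ell:\mathcal{O}_K\to\mathcal{R}$ the reduction map, $\Lambda_\ell(C)=\{u\in\mathcal{O}_K^n : (\rho_\ell(u_1),\dots,\rho_\ell(u_n))\in C\}$, and its theta series is $\theta_{\Lambda_\ell(C)}(q)=\sum_{z\in\Lambda_\ell(C)}q^{z\cdot\bar z}$, where $z\cdot\bar z=\sum_i|z_i|^2$, regarded as a formal power series in $q$. -}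

module Defs where

open import Data.Bool using (Bool; true; false; if_then_else_)
open import Data.Nat as ℕ using (ℕ; _∸_; _≤?_; _≡ᵇ_)
open import Data.Nat.DivMod using (_%_; _/_)
open import Data.Nat.Divisibility using (_∣_)
open import Data.Integer as ℤ using (ℤ; +_; ∣_∣)
open import Data.Fin using (Fin; toℕ)
open import Data.Vec using (Vec; tabulate; map; zipWith; foldr)
open import Data.Product using (Σ; ∃; _×_; _,_)
open import Relation.Binary.PropositionalEquality using (_≡_)
open import Relation.Nullary.Decidable using (⌊_⌋)

SquareFree : ℕ → Set
SquareFree ℓ = ∀ (d : ℕ) → (d ℕ.* d) ∣ ℓ → d ≡ 1

data 𝓡 : Set where
  r0 r1 rω rω1 : 𝓡      -- 0, 1, ω, ω+1

infixl 6 _⊕_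
infixl 7 _⊗_

_⊕_ : 𝓡 → 𝓡 → 𝓡
r0  ⊕ y   = y
x   ⊕ r0  = x
r1  ⊕ r1  = r0
r1  ⊕ rω  = rω1
r1  ⊕ rω1 = rω
rω  ⊕ r1  = rω1
rω  ⊕ rω  = r0
rω  ⊕ rω1 = r1
rω1 ⊕ r1  = rω
rω1 ⊕ rω  = r1
rω1 ⊕ rω1 = r0

_⊗_ : 𝓡 → 𝓡 → 𝓡
r0  ⊗ y   = r0
r1  ⊗ y   = y
rω  ⊗ r0  = r0
rω  ⊗ r1  = rω
rω  ⊗ rω  = rω      -- ω² = -ω = ω
rω  ⊗ rω1 = r0      -- ω² + ω = 0
rω1 ⊗ r0  = r0
rω1 ⊗ r1  = rω1
rω1 ⊗ rω  = r0
rω1 ⊗ rω1 = rω1     -- ω² + 2ω + 1 = ω + 1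

-- conjugation induced by  a + bω ↦ (a - b) - bω
conj : 𝓡 → 𝓡
conj r0  = r0
conj r1  = r1
conj rω  = rω1
conj rω1 = rω

_·_ : ∀ {n} → 𝓡 → Vec 𝓡 n → Vec 𝓡 n
c · v = map (c ⊗_) v

_⊞_ : ∀ {n} → Vec 𝓡 n → Vec 𝓡 n → Vec 𝓡 n
_⊞_ = zipWith _⊕_

⟪_,_⟫ : ∀ {n} → Vec 𝓡 n → Vec 𝓡 n → 𝓡
⟪ u , v ⟫ = foldr _ _⊕_ r0 (zipWith (λ a b → a ⊗ conj b) u v)

Span : ∀ {n} → Vec 𝓡 n → Vec 𝓡 n → Set
Span v x = ∃ λ (c : 𝓡) → x ≡ c · v

Perp : ∀ {n} → (Vec 𝓡 n → Set) → Vec 𝓡 n → Set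
Perp C u = ∀ w → C w → ⟪ u , w ⟫ ≡ r0

Code : ∀ {n} → 𝓡 → 𝓡 → Vec 𝓡 n → Vec 𝓡 n → Set
Code a₁ a₂ v u =
  ∃ λ x → ∃ λ y → Span v x × Perp (Span v) y × u ≡ (a₁ · x) ⊞ (a₂ · y)

v₁ : (n : ℕ) → Vec 𝓡 n
v₁ n = tabulate λ i → if ⌊ (n ∸ 2) ≤? toℕ i ⌋ then r1 else r0

v₂ : (n : ℕ) → Vec 𝓡 n
v₂ n = tabulate λ i → if ⌊ (n ∸ 1) ≤? toℕ i ⌋ then r1 else r0

C₁ : (n : ℕ) → Vec 𝓡 n → Set
C₁ n = Code rω rω1 (v₁ n)

C₂ : (n : ℕ) → Vec 𝓡 n → Set
C₂ n = Code rω rω1 (v₂ n)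

Card : {A : Set} → (A → Set) → ℕ → Set
Card {A} P k =
  Σ (Fin k → A) λ f →
    (∀ i → P (f i)) ×
    (∀ i j → f i ≡ f j → i ≡ j) ×
    (∀ a → P a → ∃ λ i → f i ≡ a)

SameCounts : {I A B : Set} → (I → A → Set) → (I → B → Set) → Set
SameCounts {I} P Q =
  ∀ (i : I) (k : ℕ) → (Card (P i) k → Card (Q i) k) × (Card (Q i) k → Card (P i) k)

-- Symmetric weight enumerator (as its coefficient family)

count : ∀ {n} → (𝓡 → Bool) → Vec 𝓡 n → ℕ
count p u = foldr _ (λ a s → if p a then ℕ.suc s else s) 0 u

is0 is1 isω∨ω1 : 𝓡 → Bool
is0 r0 = true
is0 _  = false
is1 r1 = true
is1 _  = false
isω∨ω1 rω  = true
isω∨ω1 rω1 = true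
isω∨ω1 _   = false

sweExp : ∀ {n} → Vec 𝓡 n → ℕ × ℕ × ℕ
sweExp u = count is0 u , count is1 u , count isω∨ω1 u

-- codewords contributing to the monomial X^i Y^j Z^k
SweTerm : ∀ {n} → (Vec 𝓡 n → Set) → ℕ × ℕ × ℕ → Vec 𝓡 n → Set
SweTerm C e u = C u × sweExp u ≡ e

SweEq : ∀ {n} → (Vec 𝓡 n → Set) → (Vec 𝓡 n → Set) → Set
SweEq C D = SameCounts (SweTerm C) (SweTerm D)

-- O_K = ℤ[ω_ℓ]: (a , b) represents a + b ω_ℓ

OK : Set
OK = ℤ × ℤ

odd? : ℤ → Bool
odd? a = (∣ a ∣ % 2) ≡ᵇ 1

ρ : OK → 𝓡
ρ (a , b) with odd? a | odd? b
... | false | false = r0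
... | true  | false = r1
... | false | true  = rω
... | true  | true  = rω1

-- |a + b ω_ℓ|² = a² - ab + b² (1+ℓ)/4   (ω_ℓ + ω̄_ℓ = -1, ω_ℓ ω̄_ℓ = (1+ℓ)/4)
normOK : ℕ → OK → ℤ
normOK ℓ (a , b) = (a ℤ.* a ℤ.- a ℤ.* b) ℤ.+ b ℤ.* b ℤ.* (+ ((ℓ ℕ.+ 1) / 4))

normVec : ∀ {n} → ℕ → Vec OK n → ℤ
normVec ℓ z = foldr _ ℤ._+_ (+ 0) (map (normOK ℓ) z)

Λ : ∀ {n} → (Vec 𝓡 n → Set) → Vec OK n → Set
Λ C z = C (map ρ z)

-- vectors of Λ_ℓ(C) contributing to the coefficient of q^m in θ_{Λ_ℓ(C)}
ThetaTerm : ∀ {n} → ℕ → (Vec 𝓡 n → Set) → ℕ → Vec OK n → Set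
ThetaTerm ℓ C m z = Λ C z × normVec ℓ z ≡ + m

ThetaEq : ∀ {n} → ℕ → (Vec 𝓡 n → Set) → (Vec 𝓡 n → Set) → Set
ThetaEq ℓ C D = SameCounts (ThetaTerm ℓ C) (ThetaTerm ℓ D)

module Submission where

-- Write n = 2 + k.  Both generators are a
-- pair preceded by k zeros, and a zero generator entry forces the codeword
-- entry into the ideal ⟨ω+1⟩ = {0, ω+1} and imposes nothing else.  Hence C₁
-- is "k entries in ⟨ω+1⟩, then two equal entries" and C₂ is "k entries in
-- ⟨ω+1⟩, then a pair in ⟨ω+1⟩ × ⟨ω⟩" (C₁-padded, C₂-padded).
--  • No codeword of C₂ has an entry 1, but (0,…,0,1,1) ∈ C₁: the symmetric
--    weight enumerators differ.
--  • Level 7: pairs of O_K congruent mod 2 are exactly (s + t, s − t), the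
--    pairs allowed by C₂ are exactly ((1+ω)s, −ωt), and both have norm
--    2(|s|² + |t|²); so Λ₇(C₁) and Λ₇(C₂) are parametrized compatibly by the
--    same vectors and have the same number of vectors of each norm.
--  • Level ℓ > 7: (ℓ+1)/4 ≥ 4, so a lattice vector with no residue 1 has norm
--    0 or ≥ 4; Λ_ℓ(C₂) has no vector of norm 2 while (0,…,0,1,1) ∈ Λ_ℓ(C₁).

open import Defs
open import Data.Bool using (Bool; true; false; if_then_else_)
open import Data.Empty using (⊥-elim)
open import Data.Fin using (Fin; toℕ)
open import Data.Integer as ℤ using (ℤ; +_; -[1+_]; _+_; _-_; -_; _*_; +≤+)
open import Data.Integer.DivMod using (_%ℕ_; _/ℕ_; n%ℕd<d; a≡a%ℕn+[a/ℕn]*n)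
import Data.Integer.Properties as ℤP
open import Data.Integer.Tactic.RingSolver using (solve-∀)
open import Data.Nat as ℕ using (ℕ; zero; suc; s≤s; z≤n; _≤_; _<_)
open import Data.Nat.DivMod using (_%_; m*n%n≡0; [m+kn]%n≡m%n; m*n/n≡m; m≡m%n+[m/n]*n)
import Data.Nat.Properties as ℕP
import Data.Nat.Tactic.RingSolver as ℕSolver
open import Data.Product using (∃; _×_; _,_; proj₁; proj₂)
open import Data.Sum using (_⊎_; inj₁; inj₂)
open import Data.Vec using (Vec; []; _∷_; map; tabulate)
open import Data.Vec.Properties using (∷-injectiveˡ; ∷-injectiveʳ; tabulate-cong)
open import Data.Vec.Relation.Unary.All as All using (All; []; _∷_)
open import Data.Vec.Relation.Unary.All.Properties using (map⁻)
open import Function using (_∘_)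
open import Function.Bundles using (_⇔_; mk⇔; Equivalence)
import Function.Properties.Equivalence as ⇔
open import Relation.Binary.PropositionalEquality
  using (_≡_; _≢_; refl; sym; trans; cong; cong₂; subst; module ≡-Reasoning)
open import Relation.Nullary using (¬_)
open import Relation.Nullary.Decidable using (⌊_⌋; yes; no)

open Equivalence using (to; from)

record Parametrization {X A : Set} (φ : X → A) (P : A → Set) : Set where
  field
    injective : ∀ x y → φ x ≡ φ y → x ≡ y
    onto      : ∀ a → P a → ∃ λ x → φ x ≡ a

card-transport : {X A B : Set} {P : A → Set} {Q : B → Set} {φ : X → A} {ψ : X → B} →
  Parametrization φ P → Parametrization ψ Q → (∀ x → P (φ x) → Q (ψ x)) →
  (∀ x → Q (ψ x) → P (φ x)) → ∀ k → Card P k → Card Q k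
card-transport {X = X} {P = P} {Q} {φ} {ψ} pφ pψ P⇒Q Q⇒P k (e , e∈P , e-inj , e-onto) =
  ψ ∘ param , ψparam∈Q , ψparam-inj , ψparam-onto
  where
  open Parametrization
  param : Fin k → X
  param i = proj₁ (onto pφ (e i) (e∈P i))
  φparam : ∀ i → φ (param i) ≡ e i
  φparam i = proj₂ (onto pφ (e i) (e∈P i))
  ψparam∈Q : ∀ i → Q (ψ (param i))
  ψparam∈Q i = P⇒Q (param i) (subst P (sym (φparam i)) (e∈P i))
  ψparam-inj : ∀ i j → ψ (param i) ≡ ψ (param j) → i ≡ j
  ψparam-inj i j eq = e-inj i j (begin
    e i             ≡⟨ sym (φparam i) ⟩
    φ (param i)     ≡⟨ cong φ (injective pψ _ _ eq) ⟩
    φ (param j)     ≡⟨ φparam j ⟩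
    e j             ∎)
    where open ≡-Reasoning
  ψparam-onto : ∀ b → Q b → ∃ λ i → ψ (param i) ≡ b
  ψparam-onto b b∈Q with onto pψ b b∈Q
  ... | x , refl with e-onto (φ x) (Q⇒P x b∈Q)
  ...   | i , eᵢ≡φx = i , cong ψ (injective pφ _ _ (trans (φparam i) eᵢ≡φx))

empty-card : {A : Set} {Q : A → Set} → (∀ b → ¬ Q b) → Card Q 0
empty-card Q-empty = (λ ()) , (λ ()) , (λ ()) , λ b b∈Q → ⊥-elim (Q-empty b b∈Q)

separated-counts : {I A B : Set} {P : I → A → Set} {Q : I → B → Set} (i : I) (a : A) →
  P i a → (∀ b → ¬ Q i b) → ¬ SameCounts P Q
separated-counts i a a∈P Q-empty same
  with (_ , _ , _ , P-onto) ← proj₂ (same i 0) (empty-card Q-empty)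
  with (() , _) ← P-onto a a∈P

-- Arithmetic in 𝓡 ≅ 𝔽₂ × 𝔽₂, checked on the four elements.  The elements ω
-- and ω+1 are orthogonal idempotents, so 𝓡 = ⟨ω⟩ ⊕ ⟨ω+1⟩ with ⟨ω⟩ = {0, ω}
-- and ⟨ω+1⟩ = {0, ω+1}.

⊗-zeroʳ : ∀ c → c ⊗ r0 ≡ r0
⊗-zeroʳ r0  = refl
⊗-zeroʳ r1  = refl
⊗-zeroʳ rω  = refl
⊗-zeroʳ rω1 = refl

⊗-identityʳ : ∀ c → c ⊗ r1 ≡ c
⊗-identityʳ r0  = refl
⊗-identityʳ r1  = refl
⊗-identityʳ rω  = refl
⊗-identityʳ rω1 = refl

⊕-identityʳ : ∀ c → c ⊕ r0 ≡ c
⊕-identityʳ r0  = refl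
⊕-identityʳ r1  = refl
⊕-identityʳ rω  = refl
⊕-identityʳ rω1 = refl

⊕≡0⇒≡ : ∀ x y → x ⊕ y ≡ r0 → x ≡ y
⊕≡0⇒≡ r0  y   eq = sym eq
⊕≡0⇒≡ r1  r1  _  = refl
⊕≡0⇒≡ rω  rω  _  = refl
⊕≡0⇒≡ rω1 rω1 _  = refl
⊕≡0⇒≡ r1  r0  ()
⊕≡0⇒≡ r1  rω  ()
⊕≡0⇒≡ r1  rω1 ()
⊕≡0⇒≡ rω  r0  ()
⊕≡0⇒≡ rω  r1  ()
⊕≡0⇒≡ rω  rω1 ()
⊕≡0⇒≡ rω1 r0  ()
⊕≡0⇒≡ rω1 r1  ()
⊕≡0⇒≡ rω1 rω  ()

⊕-self : ∀ c → c ⊕ (c ⊕ r0) ≡ r0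
⊕-self r0  = refl
⊕-self r1  = refl
⊕-self rω  = refl
⊕-self rω1 = refl

idempotent-split : ∀ a → a ≡ rω ⊗ (a ⊗ r1) ⊕ rω1 ⊗ a
idempotent-split r0  = refl
idempotent-split r1  = refl
idempotent-split rω  = refl
idempotent-split rω1 = refl

data _∈⟨ω+1⟩ : 𝓡 → Set where
  0∈   : r0 ∈⟨ω+1⟩
  ω+1∈ : rω1 ∈⟨ω+1⟩

data _∈⟨ω⟩ : 𝓡 → Set where
  0∈ : r0 ∈⟨ω⟩
  ω∈ : rω ∈⟨ω⟩

∈⟨ω+1⟩-multiple : ∀ y → (rω1 ⊗ y) ∈⟨ω+1⟩
∈⟨ω+1⟩-multiple r0  = 0∈
∈⟨ω+1⟩-multiple r1  = ω+1∈
∈⟨ω+1⟩-multiple rω  = 0∈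
∈⟨ω+1⟩-multiple rω1 = ω+1∈

∈⟨ω⟩-multiple : ∀ c → (rω ⊗ c) ∈⟨ω⟩
∈⟨ω⟩-multiple r0  = 0∈
∈⟨ω⟩-multiple r1  = ω∈
∈⟨ω⟩-multiple rω  = ω∈
∈⟨ω⟩-multiple rω1 = 0∈

∈⟨ω+1⟩-fixed : ∀ {a} → a ∈⟨ω+1⟩ → rω1 ⊗ a ≡ a
∈⟨ω+1⟩-fixed 0∈   = refl
∈⟨ω+1⟩-fixed ω+1∈ = refl

∈⟨ω⟩-fixed : ∀ {a} → a ∈⟨ω⟩ → rω ⊗ a ≡ a
∈⟨ω⟩-fixed 0∈ = refl
∈⟨ω⟩-fixed ω∈ = refl

∈⟨ω+1⟩⇒≢1 : ∀ {a} → a ∈⟨ω+1⟩ → a ≢ r1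
∈⟨ω+1⟩⇒≢1 0∈   ()
∈⟨ω+1⟩⇒≢1 ω+1∈ ()

∈⟨ω⟩⇒≢1 : ∀ {a} → a ∈⟨ω⟩ → a ≢ r1
∈⟨ω⟩⇒≢1 0∈ ()
∈⟨ω⟩⇒≢1 ω∈ ()

padWith : {A : Set} → A → (k : ℕ) → Vec A 2 → Vec A (2 ℕ.+ k)
padWith a zero    v = v
padWith a (suc k) v = a ∷ padWith a k v

onLastTwo : {A : Set} (k : ℕ) → (Vec A 2 → Vec A 2) → Vec A (2 ℕ.+ k) → Vec A (2 ℕ.+ k)
onLastTwo zero    f u       = f u
onLastTwo (suc k) f (a ∷ u) = a ∷ onLastTwo k f u

Padded : {A : Set} → (A → Set) → (Vec A 2 → Set) → (k : ℕ) → Vec A (2 ℕ.+ k) → Set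
Padded P T zero    u       = T u
Padded P T (suc k) (a ∷ u) = P a × Padded P T k u

module _ {A : Set} {P : A → Set} {T : Vec A 2 → Set} where

  Padded-padWith : ∀ {a v} k → P a → T v → Padded P T k (padWith a k v)
  Padded-padWith zero    Pa Tv = Tv
  Padded-padWith (suc k) Pa Tv = Pa , Padded-padWith k Pa Tv

  Padded-map : {B : Set} (h : B → A) (k : ℕ) (u : Vec B (2 ℕ.+ k)) →
    Padded P T k (map h u) ⇔ Padded (P ∘ h) (T ∘ map h) k u
  Padded-map h zero    u       = mk⇔ (λ t → t) (λ t → t)
  Padded-map h (suc k) (b ∷ u) =
    mk⇔ (λ (p , r) → p , to (Padded-map h k u) r) (λ (p , r) → p , from (Padded-map h k u) r)

  Padded-All : {R : A → Set} → (∀ {a} → P a → R a) → (∀ {v} → T v → All R v) →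
    ∀ k {u} → Padded P T k u → All R u
  Padded-All P⇒R T⇒R zero    {u}     Tu         = T⇒R Tu
  Padded-All P⇒R T⇒R (suc k) {a ∷ u} (Pa , rest) = P⇒R Pa ∷ Padded-All P⇒R T⇒R k rest

  Padded-relabel : ∀ {T' : Vec A 2 → Set} {f g} → (∀ v → T' (g v)) →
    ∀ k u → Padded P T k (onLastTwo k f u) → Padded P T' k (onLastTwo k g u)
  Padded-relabel T'g zero    u       _           = T'g u
  Padded-relabel T'g (suc k) (a ∷ u) (Pa , rest) = Pa , Padded-relabel T'g k u rest

  Padded-onto : ∀ {f} → (∀ v → T v → ∃ λ w → f w ≡ v) →
    ∀ k u → Padded P T k u → ∃ λ x → onLastTwo k f x ≡ u
  Padded-onto f-onto zero    u       Tu          = f-onto u Tu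
  Padded-onto f-onto (suc k) (a ∷ u) (Pa , rest) with Padded-onto f-onto k u rest
  ... | x , refl = a ∷ x , refl

onLastTwo-injective : {A : Set} {f : Vec A 2 → Vec A 2} → (∀ v w → f v ≡ f w → v ≡ w) →
  ∀ k u u' → onLastTwo k f u ≡ onLastTwo k f u' → u ≡ u'
onLastTwo-injective f-inj zero    u       u'        eq = f-inj u u' eq
onLastTwo-injective f-inj (suc k) (a ∷ u) (a' ∷ u') eq =
  cong₂ _∷_ (∷-injectiveˡ eq) (onLastTwo-injective f-inj k u u' (∷-injectiveʳ eq))

-- the vector (0,…,0,1,…,1) of length m whose ones start at index j;
-- v₁ (2 + k) and v₂ (2 + k) are  threshold k  and  threshold (1 + k)
threshold : ℕ → (m : ℕ) → Vec 𝓡 m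
threshold j m = tabulate λ i → if ⌊ j ℕ.≤? toℕ i ⌋ then r1 else r0

threshold-shift : ∀ j m → threshold (suc j) (suc m) ≡ r0 ∷ threshold j m
threshold-shift j m = cong (r0 ∷_) (tabulate-cong entry)
  where
  entry : (i : Fin m) → (if ⌊ suc j ℕ.≤? suc (toℕ i) ⌋ then r1 else r0)
                      ≡ (if ⌊ j ℕ.≤? toℕ i ⌋ then r1 else r0)
  entry i with suc j ℕ.≤? suc (toℕ i) | j ℕ.≤? toℕ i
  ... | yes _     | yes _   = refl
  ... | no _      | no _    = refl
  ... | yes sj≤si | no j≰i  = ⊥-elim (j≰i (ℕP.≤-pred sj≤si))
  ... | no sj≰si  | yes j≤i = ⊥-elim (sj≰si (s≤s j≤i))

threshold-padWith : ∀ j k → threshold (j ℕ.+ k) (2 ℕ.+ k) ≡ padWith r0 k (threshold j 2)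
threshold-padWith j zero    rewrite ℕP.+-identityʳ j = refl
threshold-padWith j (suc k) rewrite ℕP.+-suc j k =
  trans (threshold-shift (j ℕ.+ k) (2 ℕ.+ k)) (cong (r0 ∷_) (threshold-padWith j k))

v₁-padded : ∀ k → v₁ (2 ℕ.+ k) ≡ padWith r0 k (r1 ∷ r1 ∷ [])
v₁-padded = threshold-padWith 0

v₂-padded : ∀ k → v₂ (2 ℕ.+ k) ≡ padWith r0 k (r0 ∷ r1 ∷ [])
v₂-padded = threshold-padWith 1

OmegaCode : ∀ {m} → Vec 𝓡 m → Vec 𝓡 m → Set
OmegaCode = Code rω rω1

inner-zero-cons : ∀ {m} y₀ (y : Vec 𝓡 m) d v → ⟪ y₀ ∷ y , d · (r0 ∷ v) ⟫ ≡ ⟪ y , d · v ⟫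
inner-zero-cons y₀ y d v rewrite ⊗-zeroʳ d | ⊗-zeroʳ y₀ = refl

code-zero-cons : ∀ {m} (v : Vec 𝓡 m) a u →
  OmegaCode (r0 ∷ v) (a ∷ u) ⇔ (a ∈⟨ω+1⟩ × OmegaCode v u)
code-zero-cons v a u = mk⇔ split join
  where
  split : OmegaCode (r0 ∷ v) (a ∷ u) → a ∈⟨ω+1⟩ × OmegaCode v u
  split (_ , y₀ ∷ y , (c , refl) , y⊥ , eq) =
      subst _∈⟨ω+1⟩ (sym a≡) (∈⟨ω+1⟩-multiple y₀)
    , (c · v , y , (c , refl) , y⊥' , ∷-injectiveʳ eq)
    where
    a≡ : a ≡ rω1 ⊗ y₀
    a≡ rewrite ⊗-zeroʳ c = ∷-injectiveˡ eq
    y⊥' : Perp (Span v) y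
    y⊥' _ (d , refl) = trans (sym (inner-zero-cons y₀ y d v)) (y⊥ _ (d , refl))
  join : a ∈⟨ω+1⟩ × OmegaCode v u → OmegaCode (r0 ∷ v) (a ∷ u)
  join (a∈ , (_ , y , (c , refl) , y⊥ , refl)) =
    c · (r0 ∷ v) , a ∷ y , (c , refl) , y⊥' , cong (_∷ _) a≡
    where
    a≡ : a ≡ rω ⊗ (c ⊗ r0) ⊕ rω1 ⊗ a
    a≡ rewrite ⊗-zeroʳ c = sym (∈⟨ω+1⟩-fixed a∈)
    y⊥' : Perp (Span (r0 ∷ v)) (a ∷ y)
    y⊥' _ (d , refl) = trans (inner-zero-cons a y d v) (y⊥ _ (d , refl))

code-padded : ∀ {w T} → (∀ u → OmegaCode w u ⇔ T u) →
  ∀ k u → OmegaCode (padWith r0 k w) u ⇔ Padded _∈⟨ω+1⟩ T k u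
code-padded base zero    u       = base u
code-padded base (suc k) (a ∷ u) = mk⇔
  (λ c → let (a∈ , c') = to (code-zero-cons _ a u) c in a∈ , to (code-padded base k u) c')
  (λ (a∈ , p) → from (code-zero-cons _ a u) (a∈ , from (code-padded base k u) p))

-- ⟨(1)⟩^⊥ = 0 in length one, so the code of the generator (1) is ⟨ω⟩
code-unit : ∀ b → OmegaCode (r1 ∷ []) (b ∷ []) ⇔ b ∈⟨ω⟩
code-unit b = mk⇔ split join
  where
  split : OmegaCode (r1 ∷ []) (b ∷ []) → b ∈⟨ω⟩
  split (_ , y ∷ [] , (c , refl) , y⊥ , eq) = subst _∈⟨ω⟩ (sym b≡) (∈⟨ω⟩-multiple c)
    where
    y≡0 : y ≡ r0
    y≡0 = trans (sym (trans (⊕-identityʳ _) (⊗-identityʳ y))) (y⊥ _ (r1 , refl))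
    b≡ : b ≡ rω ⊗ c
    b≡ = begin
      b                                ≡⟨ ∷-injectiveˡ eq ⟩
      rω ⊗ (c ⊗ r1) ⊕ rω1 ⊗ y          ≡⟨ cong (λ t → rω ⊗ (c ⊗ r1) ⊕ rω1 ⊗ t) y≡0 ⟩
      rω ⊗ (c ⊗ r1) ⊕ r0               ≡⟨ ⊕-identityʳ _ ⟩
      rω ⊗ (c ⊗ r1)                    ≡⟨ cong (rω ⊗_) (⊗-identityʳ c) ⟩
      rω ⊗ c                           ∎
      where open ≡-Reasoning
  join : b ∈⟨ω⟩ → OmegaCode (r1 ∷ []) (b ∷ [])
  join b∈ = b · (r1 ∷ []) , r0 ∷ [] , (b , refl) , (λ { _ (d , refl) → refl }) , cong (_∷ []) b≡
    where
    b≡ : b ≡ rω ⊗ (b ⊗ r1) ⊕ r0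
    b≡ rewrite ⊕-identityʳ (rω ⊗ (b ⊗ r1)) | ⊗-identityʳ b = sym (∈⟨ω⟩-fixed b∈)

-- ⟨(1,1)⟩^⊥ = ⟨(1,1)⟩, so the code of the generator (1,1) is the diagonal
EqualPair : Vec 𝓡 2 → Set
EqualPair (a ∷ b ∷ []) = a ≡ b

code-diagonal : ∀ u → OmegaCode (r1 ∷ r1 ∷ []) u ⇔ EqualPair u
code-diagonal (a ∷ b ∷ []) = mk⇔ split join
  where
  split : OmegaCode (r1 ∷ r1 ∷ []) (a ∷ b ∷ []) → a ≡ b
  split (_ , y₁ ∷ y₂ ∷ [] , (c , refl) , y⊥ , eq) = begin
    a                          ≡⟨ ∷-injectiveˡ eq ⟩
    rω ⊗ (c ⊗ r1) ⊕ rω1 ⊗ y₁   ≡⟨ cong (λ t → rω ⊗ (c ⊗ r1) ⊕ rω1 ⊗ t) y₁≡y₂ ⟩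
    rω ⊗ (c ⊗ r1) ⊕ rω1 ⊗ y₂   ≡⟨ sym (∷-injectiveˡ (∷-injectiveʳ eq)) ⟩
    b                          ∎
    where
    open ≡-Reasoning
    -- ⟪ y , (1,1) ⟫ = y₁ + y₂ = 0
    y₁≡y₂ : y₁ ≡ y₂
    y₁≡y₂ = ⊕≡0⇒≡ y₁ y₂ (trans
      (cong₂ _⊕_ (sym (⊗-identityʳ y₁)) (sym (trans (⊕-identityʳ _) (⊗-identityʳ y₂))))
      (y⊥ _ (r1 , refl)))
  join : a ≡ b → OmegaCode (r1 ∷ r1 ∷ []) (a ∷ b ∷ [])
  join refl =
    a · (r1 ∷ r1 ∷ []) , a ∷ a ∷ [] , (a , refl) , a⊥ ,
    cong₂ (λ x y → x ∷ y ∷ []) (idempotent-split a) (idempotent-split a)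
    where
    a⊥ : Perp (Span (r1 ∷ r1 ∷ [])) (a ∷ a ∷ [])
    a⊥ _ (d , refl) = ⊕-self (a ⊗ conj (d ⊗ r1))

IdealPair : Vec 𝓡 2 → Set
IdealPair (a ∷ b ∷ []) = a ∈⟨ω+1⟩ × b ∈⟨ω⟩

code-ideals : ∀ u → OmegaCode (r0 ∷ r1 ∷ []) u ⇔ IdealPair u
code-ideals (a ∷ b ∷ []) = mk⇔
  (λ c → let (a∈ , c') = to (code-zero-cons _ a (b ∷ [])) c in a∈ , to (code-unit b) c')
  (λ (a∈ , b∈) → from (code-zero-cons _ a (b ∷ [])) (a∈ , from (code-unit b) b∈))

C₁-padded : ∀ k u → C₁ (2 ℕ.+ k) u ⇔ Padded _∈⟨ω+1⟩ EqualPair k u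
C₁-padded k u = subst (λ w → OmegaCode w u ⇔ Padded _∈⟨ω+1⟩ EqualPair k u)
                      (sym (v₁-padded k)) (code-padded code-diagonal k u)

C₂-padded : ∀ k u → C₂ (2 ℕ.+ k) u ⇔ Padded _∈⟨ω+1⟩ IdealPair k u
C₂-padded k u = subst (λ w → OmegaCode w u ⇔ Padded _∈⟨ω+1⟩ IdealPair k u)
                      (sym (v₂-padded k)) (code-padded code-ideals k u)

C₂-avoids-1 : ∀ k u → C₂ (2 ℕ.+ k) u → All (_≢ r1) u
C₂-avoids-1 k u c = Padded-All ∈⟨ω+1⟩⇒≢1 pair-avoids-1 k (to (C₂-padded k u) c)
  where
  pair-avoids-1 : ∀ {v} → IdealPair v → All (_≢ r1) v
  pair-avoids-1 {_ ∷ _ ∷ []} (a∈ , b∈) = ∈⟨ω+1⟩⇒≢1 a∈ ∷ ∈⟨ω⟩⇒≢1 b∈ ∷ []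

-- Parity in ℤ.  odd? is defined through |a| mod 2; we only need that it
-- detects the class of a modulo 2.

double≡*2 : ∀ m → m ℕ.+ m ≡ m ℕ.* 2
double≡*2 m = trans (cong (m ℕ.+_) (sym (ℕP.+-identityʳ m))) (ℕP.*-comm 2 m)

odd?-double : ∀ h → odd? (h + h) ≡ false
odd?-double (+ m)    = cong (ℕ._≡ᵇ 1) (trans (cong (ℕ._% 2) (double≡*2 m)) (m*n%n≡0 m 2))
odd?-double -[1+ m ] =
  cong (ℕ._≡ᵇ 1) (trans (cong (λ x → suc (suc x) ℕ.% 2) (double≡*2 m)) (m*n%n≡0 (suc m) 2))

odd?-double+1 : ∀ h → odd? (+ 1 + (h + h)) ≡ true
odd?-double+1 (+ m)    =
  cong (ℕ._≡ᵇ 1) (trans (cong (λ x → suc x ℕ.% 2) (double≡*2 m)) ([m+kn]%n≡m%n 1 m 2))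
odd?-double+1 -[1+ m ] =
  cong (ℕ._≡ᵇ 1) (trans (cong (λ x → suc x ℕ.% 2) (double≡*2 m)) ([m+kn]%n≡m%n 1 m 2))

parity-split : ∀ a → ∃ λ h → a ≡ h + h ⊎ a ≡ + 1 + (h + h)
parity-split a = by-remainder (a %ℕ 2) (n%ℕd<d a 2) (a≡a%ℕn+[a/ℕn]*n a 2)
  where
  h : ℤ
  h = a /ℕ 2
  by-remainder : ∀ r → r ℕ.< 2 → a ≡ + r + h * + 2 → ∃ λ h → a ≡ h + h ⊎ a ≡ + 1 + (h + h)
  by-remainder 0 _ eq = h , inj₁ (trans eq (even h))
    where even : ∀ h → + 0 + h * + 2 ≡ h + h
          even = solve-∀
  by-remainder 1 _ eq = h , inj₂ (trans eq (odd h))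
    where odd : ∀ h → + 1 + h * + 2 ≡ + 1 + (h + h)
          odd = solve-∀
  by-remainder (suc (suc r)) (s≤s (s≤s ())) _

odd?-shift : ∀ y h → odd? (y + (h + h)) ≡ odd? y
odd?-shift y h with parity-split y
... | g , inj₁ refl =
  trans (cong odd? (regroup g h)) (trans (odd?-double (g + h)) (sym (odd?-double g)))
  where regroup : ∀ g h → (g + g) + (h + h) ≡ (g + h) + (g + h)
        regroup = solve-∀
... | g , inj₂ refl =
  trans (cong odd? (regroup g h)) (trans (odd?-double+1 (g + h)) (sym (odd?-double+1 g)))
  where regroup : ∀ g h → (+ 1 + (g + g)) + (h + h) ≡ + 1 + ((g + h) + (g + h))
        regroup = solve-∀

same-parity : ∀ x y → odd? x ≡ odd? y → ∃ λ h → x ≡ y + (h + h)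
same-parity x y eq with parity-split x | parity-split y
... | g , inj₁ refl | g' , inj₁ refl = g - g' , shift g g'
  where shift : ∀ g g' → g + g ≡ (g' + g') + ((g - g') + (g - g'))
        shift = solve-∀
... | g , inj₂ refl | g' , inj₂ refl = g - g' , shift g g'
  where shift : ∀ g g' → + 1 + (g + g) ≡ (+ 1 + (g' + g')) + ((g - g') + (g - g'))
        shift = solve-∀
... | g , inj₁ refl | g' , inj₂ refl
  with () ← trans (sym (odd?-double g)) (trans eq (odd?-double+1 g'))
... | g , inj₂ refl | g' , inj₁ refl
  with () ← trans (sym (odd?-double+1 g)) (trans eq (odd?-double g'))

residue : Bool → Bool → 𝓡
residue false false = r0
residue true  false = r1
residue false true  = rω
residue true  true  = rω1

ρ-residue : ∀ a b → ρ (a , b) ≡ residue (odd? a) (odd? b)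
ρ-residue a b with odd? a | odd? b
... | false | false = refl
... | true  | false = refl
... | false | true  = refl
... | true  | true  = refl

parities : 𝓡 → Bool × Bool
parities r0  = false , false
parities r1  = true  , false
parities rω  = false , true
parities rω1 = true  , true

parities-residue : ∀ p q → parities (residue p q) ≡ (p , q)
parities-residue false false = refl
parities-residue true  false = refl
parities-residue false true  = refl
parities-residue true  true  = refl

ρ-parities : ∀ a b → parities (ρ (a , b)) ≡ (odd? a , odd? b)
ρ-parities a b = trans (cong parities (ρ-residue a b)) (parities-residue (odd? a) (odd? b))

ρ≡ρ⇔ : ∀ a b a' b' → ρ (a , b) ≡ ρ (a' , b') ⇔ (odd? a ≡ odd? a' × odd? b ≡ odd? b')
ρ≡ρ⇔ a b a' b' = mk⇔
  (λ eq → let same = trans (sym (ρ-parities a b)) (trans (cong parities eq) (ρ-parities a' b'))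
          in cong proj₁ same , cong proj₂ same)
  (λ (eqa , eqb) → trans (ρ-residue a b) (trans (cong₂ residue eqa eqb) (sym (ρ-residue a' b'))))

ρ∈⟨ω+1⟩⇔ : ∀ a b → ρ (a , b) ∈⟨ω+1⟩ ⇔ odd? a ≡ odd? b
ρ∈⟨ω+1⟩⇔ a b rewrite ρ-residue a b = mk⇔ (split (odd? a) (odd? b)) join
  where
  split : ∀ p q → residue p q ∈⟨ω+1⟩ → p ≡ q
  split false false _ = refl
  split true  true  _ = refl
  split true  false ()
  split false true  ()
  join : ∀ {p q} → p ≡ q → residue p q ∈⟨ω+1⟩
  join {false} refl = 0∈
  join {true}  refl = ω+1∈

ρ∈⟨ω⟩⇔ : ∀ a b → ρ (a , b) ∈⟨ω⟩ ⇔ odd? a ≡ false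
ρ∈⟨ω⟩⇔ a b rewrite ρ-residue a b = mk⇔ (split (odd? a) (odd? b)) (join (odd? b))
  where
  split : ∀ p q → residue p q ∈⟨ω⟩ → p ≡ false
  split false _     _ = refl
  split true  false ()
  split true  true  ()
  join : ∀ q {p} → p ≡ false → residue p q ∈⟨ω⟩
  join false refl = 0∈
  join true  refl = ω∈

ρ≢1⇒even : ∀ a → ρ (a , + 0) ≢ r1 → odd? a ≡ false
ρ≢1⇒even a ρ≢1 = residue≢1 (odd? a) (λ eq → ρ≢1 (trans (ρ-residue a (+ 0)) eq))
  where
  residue≢1 : ∀ p → residue p false ≢ r1 → p ≡ false
  residue≢1 false _   = refl
  residue≢1 true  ≢r1 = ⊥-elim (≢r1 refl)

double-injective : ∀ h h' → h + h ≡ h' + h' → h ≡ h'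
double-injective h h' eq = ℤP.*-cancelˡ-≡ (+ 2) h h' (trans (twice h) (trans eq (sym (twice h'))))
  where twice : ∀ h → + 2 * h ≡ h + h
        twice = solve-∀

sum-diff-injective : ∀ x y x' y' → x + y ≡ x' + y' → x - y ≡ x' - y' → x ≡ x' × y ≡ y'
sum-diff-injective x y x' y' e₊ e₋ =
    double-injective x x' (trans (recover-x x y) (trans (cong₂ _+_ e₊ e₋) (sym (recover-x x' y'))))
  , double-injective y y' (trans (recover-y x y) (trans (cong₂ _-_ e₊ e₋) (sym (recover-y x' y'))))
  where
  recover-x : ∀ x y → x + x ≡ (x + y) + (x - y)
  recover-x = solve-∀
  recover-y : ∀ x y → y + y ≡ (x + y) - (x - y)
  recover-y = solve-∀

recover-subtrahend : ∀ a c → c ≡ a - (a - c)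
recover-subtrahend = solve-∀

-- Level 7: O_K = ℤ[ω] with ω² = −ω − 2, and |a + bω|² = a² − ab + 2b².
-- Two parametrizations of pairs in O_K² by pairs (s , t):
--   sumDiff (s , t) = (s + t , s − t)   hits exactly the pairs congruent mod 2;
--   twist   (s , t) = ((1+ω) s , −ω t)  hits exactly the pairs with residues
--                                        in ⟨ω+1⟩ × ⟨ω⟩.
-- Since |1+ω|² = |ω|² = 2, both have norm 2(|s|² + |t|²).

_⊹_ _⊟_ : OK → OK → OK
(a , b) ⊹ (c , d) = a + c , b + d
(a , b) ⊟ (c , d) = a - c , b - d

-- multiplication by 1 + ω and by −ω in ℤ[ω] for ω² = −ω − 2
times1+ω : OK → OK
times1+ω (a , b) = a - (b + b) , a

times-ω : OK → OK
times-ω (a , b) = b + b , b - a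

sumDiff : Vec OK 2 → Vec OK 2
sumDiff (s ∷ t ∷ []) = s ⊹ t ∷ s ⊟ t ∷ []

twist : Vec OK 2 → Vec OK 2
twist (s ∷ t ∷ []) = times1+ω s ∷ times-ω t ∷ []

parallelogram : ∀ ℓ s t →
  normOK ℓ (s ⊹ t) + normOK ℓ (s ⊟ t) ≡ (normOK ℓ s + normOK ℓ s) + (normOK ℓ t + normOK ℓ t)
parallelogram ℓ (a , b) (c , d) = identity a b c d (+ ((ℓ ℕ.+ 1) ℕ./ 4))
  where
  identity : ∀ a b c d M →
      (((a + c) * (a + c) - (a + c) * (b + d)) + (b + d) * (b + d) * M)
    + (((a - c) * (a - c) - (a - c) * (b - d)) + (b - d) * (b - d) * M)
    ≡ ((((a * a - a * b) + b * b * M) + ((a * a - a * b) + b * b * M))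
    +  (((c * c - c * d) + d * d * M) + ((c * c - c * d) + d * d * M)))
  identity = solve-∀

norm-times1+ω : ∀ s → normOK 7 (times1+ω s) ≡ normOK 7 s + normOK 7 s
norm-times1+ω (a , b) = identity a b
  where
  identity : ∀ a b →
      ((a - (b + b)) * (a - (b + b)) - (a - (b + b)) * a) + a * a * + 2
    ≡ ((a * a - a * b) + b * b * + 2) + ((a * a - a * b) + b * b * + 2)
  identity = solve-∀

norm-times-ω : ∀ t → normOK 7 (times-ω t) ≡ normOK 7 t + normOK 7 t
norm-times-ω (a , b) = identity a b
  where
  identity : ∀ a b →
      ((b + b) * (b + b) - (b + b) * (b - a)) + (b - a) * (b - a) * + 2
    ≡ ((a * a - a * b) + b * b * + 2) + ((a * a - a * b) + b * b * + 2)
  identity = solve-∀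

sumDiff-twist-norm : ∀ v → normVec 7 (sumDiff v) ≡ normVec 7 (twist v)
sumDiff-twist-norm (s ∷ t ∷ []) = begin
  N (s ⊹ t) + (N (s ⊟ t) + + 0)
    ≡⟨ cong (λ x → N (s ⊹ t) + x) (ℤP.+-identityʳ _) ⟩
  N (s ⊹ t) + N (s ⊟ t)
    ≡⟨ parallelogram 7 s t ⟩
  (N s + N s) + (N t + N t)
    ≡⟨ cong₂ _+_ (sym (norm-times1+ω s)) (sym (norm-times-ω t)) ⟩
  N (times1+ω s) + N (times-ω t)
    ≡⟨ cong (λ x → N (times1+ω s) + x) (sym (ℤP.+-identityʳ _)) ⟩
  N (times1+ω s) + (N (times-ω t) + + 0)
    ∎
  where
  open ≡-Reasoning
  N : OK → ℤ
  N = normOK 7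

⊹⊟-injective : ∀ s t s' t' → s ⊹ t ≡ s' ⊹ t' → s ⊟ t ≡ s' ⊟ t' → s ≡ s' × t ≡ t'
⊹⊟-injective (a , b) (c , d) (a' , b') (c' , d') e₊ e₋
  with sum-diff-injective a c a' c' (cong proj₁ e₊) (cong proj₁ e₋)
     | sum-diff-injective b d b' d' (cong proj₂ e₊) (cong proj₂ e₋)
... | refl , refl | refl , refl = refl , refl

sumDiff-injective : ∀ v w → sumDiff v ≡ sumDiff w → v ≡ w
sumDiff-injective (s ∷ t ∷ []) (s' ∷ t' ∷ []) eq
  with ⊹⊟-injective s t s' t' (∷-injectiveˡ eq) (∷-injectiveˡ (∷-injectiveʳ eq))
... | refl , refl = refl

times1+ω-injective : ∀ s s' → times1+ω s ≡ times1+ω s' → s ≡ s'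
times1+ω-injective (a , b) (a' , b') eq with cong proj₂ eq
... | refl = cong (a ,_) (double-injective b b' (begin
  b + b                ≡⟨ recover-subtrahend a (b + b) ⟩
  a - (a - (b + b))    ≡⟨ cong (λ x → a - x) (cong proj₁ eq) ⟩
  a - (a - (b' + b'))  ≡⟨ sym (recover-subtrahend a (b' + b')) ⟩
  b' + b'              ∎))
  where open ≡-Reasoning

times-ω-injective : ∀ t t' → times-ω t ≡ times-ω t' → t ≡ t'
times-ω-injective (a , b) (a' , b') eq with double-injective b b' (cong proj₁ eq)
... | refl = cong (_, b) (begin
  a            ≡⟨ recover-subtrahend b a ⟩
  b - (b - a)  ≡⟨ cong (λ x → b - x) (cong proj₂ eq) ⟩
  b - (b - a') ≡⟨ sym (recover-subtrahend b a') ⟩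
  a'           ∎)
  where open ≡-Reasoning

twist-injective : ∀ v w → twist v ≡ twist w → v ≡ w
twist-injective (s ∷ t ∷ []) (s' ∷ t' ∷ []) eq =
  cong₂ (λ x y → x ∷ y ∷ [])
    (times1+ω-injective s s' (∷-injectiveˡ eq))
    (times-ω-injective t t' (∷-injectiveˡ (∷-injectiveʳ eq)))

odd?-sum-diff : ∀ x y → odd? (x + y) ≡ odd? (x - y)
odd?-sum-diff x y = trans (cong odd? (regroup x y)) (odd?-shift (x - y) y)
  where regroup : ∀ x y → x + y ≡ (x - y) + (y + y)
        regroup = solve-∀

sumDiff-residues : ∀ w → EqualPair (map ρ (sumDiff w))
sumDiff-residues ((a , b) ∷ (c , d) ∷ []) =
  from (ρ≡ρ⇔ (a + c) (b + d) (a - c) (b - d)) (odd?-sum-diff a c , odd?-sum-diff b d)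

twist-residues : ∀ w → IdealPair (map ρ (twist w))
twist-residues ((a , b) ∷ (c , d) ∷ []) =
    from (ρ∈⟨ω+1⟩⇔ (a - (b + b)) a) (trans (cong odd? (regroup a b)) (odd?-shift a (- b)))
  , from (ρ∈⟨ω⟩⇔ (d + d) (d - c)) (odd?-double d)
  where regroup : ∀ a b → a - (b + b) ≡ a + ((- b) + (- b))
        regroup = solve-∀

sumDiff-onto : ∀ v → EqualPair (map ρ v) → ∃ λ w → sumDiff w ≡ v
sumDiff-onto ((a , b) ∷ (c , d) ∷ []) ρ≡ρ
  with (same-a , same-b) ← to (ρ≡ρ⇔ a b c d) ρ≡ρ
  with same-parity a c same-a | same-parity b d same-b
... | h , refl | g , refl =
  (c + h , d + g) ∷ (h , g) ∷ [] ,
  cong₂ (λ x y → x ∷ y ∷ []) (cong₂ _,_ (sum c h) (sum d g)) (cong₂ _,_ (diff c h) (diff d g))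
  where
  sum : ∀ y h → (y + h) + h ≡ y + (h + h)
  sum = solve-∀
  diff : ∀ y h → (y + h) - h ≡ y
  diff = solve-∀

-- an ⟨ω+1⟩-residue is divisible by 1 + ω and an ⟨ω⟩-residue by ω
twist-onto : ∀ v → IdealPair (map ρ v) → ∃ λ w → twist w ≡ v
twist-onto ((a , b) ∷ (c , d) ∷ []) (a∈ , c∈)
  with same-parity a b (to (ρ∈⟨ω+1⟩⇔ a b) a∈) | same-parity c (+ 0) (to (ρ∈⟨ω⟩⇔ c d) c∈)
... | h , refl | g , refl =
  (b , - h) ∷ (g - d , g) ∷ [] ,
  cong₂ (λ x y → x ∷ y ∷ [])
    (cong (_, b) (first b h)) (cong₂ _,_ (second g) (sym (recover-subtrahend g d)))
  where
  first : ∀ b h → b - ((- h) + (- h)) ≡ b + (h + h)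
  first = solve-∀
  second : ∀ g → g + g ≡ + 0 + (g + g)
  second = solve-∀

Λ₁-padded : ∀ k z → Λ (C₁ (2 ℕ.+ k)) z ⇔ Padded (_∈⟨ω+1⟩ ∘ ρ) (EqualPair ∘ map ρ) k z
Λ₁-padded k z = ⇔.trans (C₁-padded k (map ρ z)) (Padded-map ρ k z)

Λ₂-padded : ∀ k z → Λ (C₂ (2 ℕ.+ k)) z ⇔ Padded (_∈⟨ω+1⟩ ∘ ρ) (IdealPair ∘ map ρ) k z
Λ₂-padded k z = ⇔.trans (C₂-padded k (map ρ z)) (Padded-map ρ k z)

onLastTwo-normVec : ∀ ℓ {f g : Vec OK 2 → Vec OK 2} → (∀ v → normVec ℓ (f v) ≡ normVec ℓ (g v)) →
  ∀ k u → normVec ℓ (onLastTwo k f u) ≡ normVec ℓ (onLastTwo k g u)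
onLastTwo-normVec ℓ same zero    u       = same u
onLastTwo-normVec ℓ same (suc k) (z ∷ u) =
  cong (λ x → normOK ℓ z + x) (onLastTwo-normVec ℓ same k u)

-- θ_{Λ₇(C₁)} = θ_{Λ₇(C₂)}: both sets of lattice vectors of norm m are
-- parametrized by the same vectors, through sumDiff resp. twist on the last pair
theta-level-7 : ∀ k → ThetaEq 7 (C₁ (2 ℕ.+ k)) (C₂ (2 ℕ.+ k))
theta-level-7 k m c = card-transport p₁ p₂ 1⇒2 2⇒1 c , card-transport p₂ p₁ 2⇒1 1⇒2 c
  where
  p₁ : Parametrization (onLastTwo k sumDiff) (ThetaTerm 7 (C₁ (2 ℕ.+ k)) m)
  p₁ = record
    { injective = onLastTwo-injective sumDiff-injective k
    ; onto      = λ z (z∈ , _) → Padded-onto sumDiff-onto k z (to (Λ₁-padded k z) z∈) }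
  p₂ : Parametrization (onLastTwo k twist) (ThetaTerm 7 (C₂ (2 ℕ.+ k)) m)
  p₂ = record
    { injective = onLastTwo-injective twist-injective k
    ; onto      = λ z (z∈ , _) → Padded-onto twist-onto k z (to (Λ₂-padded k z) z∈) }
  same-norm : ∀ x → normVec 7 (onLastTwo k sumDiff x) ≡ normVec 7 (onLastTwo k twist x)
  same-norm = onLastTwo-normVec 7 sumDiff-twist-norm k
  1⇒2 : ∀ x → ThetaTerm 7 (C₁ (2 ℕ.+ k)) m (onLastTwo k sumDiff x)
            → ThetaTerm 7 (C₂ (2 ℕ.+ k)) m (onLastTwo k twist x)
  1⇒2 x (x∈ , norm) =
      from (Λ₂-padded k _) (Padded-relabel twist-residues k x (to (Λ₁-padded k _) x∈))
    , trans (sym (same-norm x)) norm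
  2⇒1 : ∀ x → ThetaTerm 7 (C₂ (2 ℕ.+ k)) m (onLastTwo k twist x)
            → ThetaTerm 7 (C₁ (2 ℕ.+ k)) m (onLastTwo k sumDiff x)
  2⇒1 x (x∈ , norm) =
      from (Λ₁-padded k _) (Padded-relabel sumDiff-residues k x (to (Λ₂-padded k _) x∈))
    , trans (same-norm x) norm

count-none : ∀ p {n} (u : Vec 𝓡 n) → All (λ a → p a ≡ false) u → count p u ≡ 0
count-none p []      []            = refl
count-none p (a ∷ u) (pa≡f ∷ rest) rewrite pa≡f = count-none p u rest

≢1⇒is1-false : ∀ {a} → a ≢ r1 → is1 a ≡ false
≢1⇒is1-false {r0}  _   = refl
≢1⇒is1-false {r1}  ≢r1 = ⊥-elim (≢r1 refl)
≢1⇒is1-false {rω}  _   = refl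
≢1⇒is1-false {rω1} _   = refl

count-is1-padded-ones : ∀ k → count is1 (padWith r0 k (r1 ∷ r1 ∷ [])) ≡ 2
count-is1-padded-ones zero    = refl
count-is1-padded-ones (suc k) = count-is1-padded-ones k

swe-differ : ∀ k → ¬ SweEq (C₁ (2 ℕ.+ k)) (C₂ (2 ℕ.+ k))
swe-differ k = separated-counts (sweExp ones) ones (ones∈C₁ , refl) no-C₂-word
  where
  ones : Vec 𝓡 (2 ℕ.+ k)
  ones = padWith r0 k (r1 ∷ r1 ∷ [])
  ones∈C₁ : C₁ (2 ℕ.+ k) ones
  ones∈C₁ = from (C₁-padded k ones) (Padded-padWith k 0∈ refl)
  no-C₂-word : ∀ u → ¬ SweTerm (C₂ (2 ℕ.+ k)) (sweExp ones) u
  no-C₂-word u (u∈ , same-exp)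
    with () ← trans (sym (count-none is1 u (All.map ≢1⇒is1-false (C₂-avoids-1 k u u∈))))
                    (trans (cong (proj₁ ∘ proj₂) same-exp) (count-is1-padded-ones k))

-- ℓ ≡ 7 mod 8 and ℓ > 7 give ℓ ≥ 15, so (ℓ + 1)/4 ≥ 4
quarter-bound : ∀ ℓ → ℓ % 8 ≡ 7 → 7 < ℓ → ∃ λ K → (ℓ ℕ.+ 1) ℕ./ 4 ≡ 4 ℕ.+ K
quarter-bound ℓ ℓ%8≡7 7<ℓ =
  by-quotient (ℓ ℕ./ 8) (trans (m≡m%n+[m/n]*n ℓ 8) (cong (ℕ._+ (ℓ ℕ./ 8) ℕ.* 8) ℓ%8≡7))
  where
  by-quotient : ∀ q → ℓ ≡ 7 ℕ.+ q ℕ.* 8 → ∃ λ K → (ℓ ℕ.+ 1) ℕ./ 4 ≡ 4 ℕ.+ K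
  by-quotient zero    refl = ⊥-elim (ℕP.<-irrefl refl 7<ℓ)
  by-quotient (suc q) refl = q ℕ.* 2 , trans (cong (ℕ._/ 4) (regroup q)) (m*n/n≡m (4 ℕ.+ q ℕ.* 2) 4)
    where regroup : ∀ q → (7 ℕ.+ (1 ℕ.+ q) ℕ.* 8) ℕ.+ 1 ≡ (4 ℕ.+ q ℕ.* 2) ℕ.* 4
          regroup = ℕSolver.solve-∀

Gapped : ℤ → Set
Gapped v = v ≡ + 0 ⊎ + 4 ℤ.≤ v

Gapped-+ : ∀ {x y} → Gapped x → Gapped y → Gapped (x + y)
Gapped-+ {y = y} (inj₁ refl) gy          = subst Gapped (sym (ℤP.+-identityˡ y)) gy
Gapped-+ {x = x} (inj₂ 4≤x)  (inj₁ refl) = inj₂ (subst (+ 4 ℤ.≤_) (sym (ℤP.+-identityʳ x)) 4≤x)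
Gapped-+         (inj₂ 4≤x)  (inj₂ 4≤y)  =
  inj₂ (ℤP.≤-trans (+≤+ (ℕP.m≤m+n 4 4)) (ℤP.+-mono-≤ 4≤x 4≤y))

square-nonneg : ∀ x → + 0 ℤ.≤ x * x
square-nonneg (+ zero)  = +≤+ z≤n
square-nonneg (+ suc n) = +≤+ z≤n
square-nonneg -[1+ n ]  = +≤+ z≤n

square-pos : ∀ x → x ≢ + 0 → + 1 ℤ.≤ x * x
square-pos (+ zero)  x≢0 = ⊥-elim (x≢0 refl)
square-pos (+ suc n) _   = +≤+ (s≤s z≤n)
square-pos -[1+ n ]  _   = +≤+ (s≤s z≤n)

half-bound : ∀ N → + 7 ℤ.≤ N + N → + 4 ℤ.≤ N
half-bound (+ n) (+≤+ 7≤2n) with 4 ℕ.≤? n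
... | yes 4≤n = +≤+ 4≤n
... | no  4≰n = ⊥-elim (7≰6 (ℕP.≤-trans 7≤2n (ℕP.+-mono-≤ n≤3 n≤3)))
  where
  n≤3 : n ℕ.≤ 3
  n≤3 = ℕP.≤-pred (ℕP.≰⇒> 4≰n)
  7≰6 : ¬ (7 ℕ.≤ 6)
  7≰6 (s≤s (s≤s (s≤s (s≤s (s≤s (s≤s ()))))))
half-bound -[1+ n ] ()

-- for b ≠ 0 and M = 4 + K:  2(a² − ab + M b²) = a² + (a − b)² + 7b² + 2K b² ≥ 7
twice-norm-bound : ∀ K a b → b ≢ + 0 →
  + 7 ℤ.≤ ((a * a - a * b) + b * b * + (4 ℕ.+ K)) + ((a * a - a * b) + b * b * + (4 ℕ.+ K))
twice-norm-bound K a b b≢0 = subst (+ 7 ℤ.≤_) (sym (expand a b (+ K))) bound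
  where
  expand : ∀ a b k → ((a * a - a * b) + b * b * (+ 4 + k)) + ((a * a - a * b) + b * b * (+ 4 + k))
                   ≡ ((a * a + (a - b) * (a - b)) + + 7 * (b * b)) + (k + k) * (b * b)
  expand = solve-∀
  extra≥0 : + 0 ℤ.≤ (+ K + + K) * (b * b)
  extra≥0 = subst (ℤ._≤ (+ K + + K) * (b * b)) (ℤP.*-zeroʳ (+ K + + K))
                  (ℤP.*-monoˡ-≤-nonNeg (+ K + + K) (square-nonneg b))
  bound : + 7 ℤ.≤ ((a * a + (a - b) * (a - b)) + + 7 * (b * b)) + (+ K + + K) * (b * b)
  bound = ℤP.+-mono-≤ (ℤP.+-mono-≤ (ℤP.+-mono-≤ (square-nonneg a) (square-nonneg (a - b)))
                                   (ℤP.*-monoˡ-≤-nonNeg (+ 7) (square-pos b b≢0)))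
                      extra≥0

coordinate-gapped : ∀ K a b → (b ≡ + 0 → odd? a ≡ false) →
  Gapped ((a * a - a * b) + b * b * + (4 ℕ.+ K))
coordinate-gapped K a (+ zero) a-even with same-parity a (+ 0) (a-even refl)
... | h , refl = subst Gapped (sym (four-squares h (+ (4 ℕ.+ K)))) (four-times h)
  where
  four-squares : ∀ h M → ((+ 0 + (h + h)) * (+ 0 + (h + h)) - (+ 0 + (h + h)) * + 0) + + 0 * + 0 * M
                       ≡ + 4 * (h * h)
  four-squares = solve-∀
  four-times : ∀ h → Gapped (+ 4 * (h * h))
  four-times (+ zero) = inj₁ refl
  four-times h@(+ suc _) = inj₂ (ℤP.*-monoˡ-≤-nonNeg (+ 4) (square-pos h (λ ())))
  four-times h@(-[1+ _ ]) = inj₂ (ℤP.*-monoˡ-≤-nonNeg (+ 4) (square-pos h (λ ())))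
coordinate-gapped K a b@(+ suc _)  _ = inj₂ (half-bound _ (twice-norm-bound K a b (λ ())))
coordinate-gapped K a b@(-[1+ _ ]) _ = inj₂ (half-bound _ (twice-norm-bound K a b (λ ())))

normVec-gapped : ∀ ℓ K → (ℓ ℕ.+ 1) ℕ./ 4 ≡ 4 ℕ.+ K →
  ∀ {n} (z : Vec OK n) → All (λ x → ρ x ≢ r1) z → Gapped (normVec ℓ z)
normVec-gapped ℓ K quarter []            []           = inj₁ refl
normVec-gapped ℓ K quarter ((a , b) ∷ z) (ρ≢1 ∷ rest) =
  Gapped-+ (subst (λ M → Gapped ((a * a - a * b) + b * b * + M)) (sym quarter)
                  (coordinate-gapped K a b (λ { refl → ρ≢1⇒even a ρ≢1 })))
           (normVec-gapped ℓ K quarter z rest)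

2-not-gapped : ¬ Gapped (+ 2)
2-not-gapped (inj₁ ())
2-not-gapped (inj₂ (+≤+ (s≤s (s≤s ()))))

normVec-padWith-0 : ∀ ℓ k v → normVec ℓ (padWith (+ 0 , + 0) k v) ≡ normVec ℓ v
normVec-padWith-0 ℓ zero    v = refl
normVec-padWith-0 ℓ (suc k) v = trans (ℤP.+-identityˡ _) (normVec-padWith-0 ℓ k v)

theta-differ : ∀ k ℓ → ℓ % 8 ≡ 7 → 7 < ℓ → ¬ ThetaEq ℓ (C₁ (2 ℕ.+ k)) (C₂ (2 ℕ.+ k))
theta-differ k ℓ ℓ%8≡7 7<ℓ = separated-counts 2 ones (ones∈Λ₁ , ones-norm) no-C₂-vector
  where
  ones : Vec OK (2 ℕ.+ k)
  ones = padWith (+ 0 , + 0) k ((+ 1 , + 0) ∷ (+ 1 , + 0) ∷ [])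
  ones∈Λ₁ : Λ (C₁ (2 ℕ.+ k)) ones
  ones∈Λ₁ = from (Λ₁-padded k ones) (Padded-padWith k 0∈ refl)
  ones-norm : normVec ℓ ones ≡ + 2
  ones-norm = normVec-padWith-0 ℓ k _
  no-C₂-vector : ∀ z → ¬ ThetaTerm ℓ (C₂ (2 ℕ.+ k)) 2 z
  no-C₂-vector z (z∈ , norm≡2) with (K , quarter) ← quarter-bound ℓ ℓ%8≡7 7<ℓ =
    2-not-gapped (subst Gapped norm≡2 (normVec-gapped ℓ K quarter z (map⁻ (C₂-avoids-1 k _ z∈))))

-- n = 2 + k; the level-ℓ statement uses only ℓ ≡ 7 (mod 8) and ℓ > 7, not
-- square-freeness
theorem3p3 : ∀ (n : ℕ) → 2 ≤ n →
    ¬ SweEq (C₁ n) (C₂ n)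
    × ThetaEq 7 (C₁ n) (C₂ n)
    × (∀ (ℓ : ℕ) → SquareFree ℓ → ℓ % 8 ≡ 7 → 7 < ℓ →
         ¬ ThetaEq ℓ (C₁ n) (C₂ n))
theorem3p3 (suc (suc k)) (s≤s (s≤s z≤n)) =
    swe-differ k
  , theta-level-7 k
  , λ ℓ _ ℓ%8≡7 7<ℓ → theta-differ k ℓ ℓ%8≡7 7<ℓ
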